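{- Let $f,g,f',g':\omega\to\omega$ with positive values and $f>g$ pointwise. Assume that $\langle w_i:i\in\omega\rangle$ is a partition of $\omega$ into finite sets and that for each $i$ there are functions $H^i_l$ ($l\in w_i$) such that (a) $\mathrm{dom}\,H^i_l=\{0,\ldots,f'(i)-1\}$; (b) $\mathrm{rng}\,H^i_l\subseteq\{0,\ldots,f(l)-1\}$; (c) whenever $\langle u_l:l\in w_i\rangle$ satisfies $u_l\subseteq\{0,\ldots,f(l)-1\}$ and $|u_l|\le g(l)$ for all $l\in w_i$, the set $\{n<f'(i):\forall l\in w_i\ H^i_l(n)\in u_l\}$ has cardinality $\le g'(i)$. Then $\mathfrak{c}(f',g')\le\mathfrak{c}(f,g)$.
   Context: For $g:\omega\to\omega$ with all values $\ge 1$, a $g$-slalom is a sequence $\bar B=\langle B_k:k\in\omega\rangle$ of sets $B_k\subseteq\omega$ with $|B_k|=g(k)$; a function $h:\omega\to\omega$ is in $\bar B$ if $h(k)\in B_k$ for all $k$. For $f,g:\omega\to\omega$ with positive values, $\mathfrak{c}(f,g)$ is the least cardinality of a family of $g$-slaloms such that every $h$ with $h(k)<f(k)$ for all $k$ is in some member of the family. -}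

module Defs where

open import Data.Nat using (ℕ; _<_; _≤_)
open import Data.Fin using (Fin)
open import Data.Product using (Σ; ∃; _×_)
open import Data.List using (List; length)
open import Data.List.Membership.Propositional using (_∈_)
open import Data.List.Relation.Unary.Unique.Propositional using (Unique)
open import Relation.Binary.PropositionalEquality using (_≡_)
open import Function.Definitions using (Injective)

record Slalom (g : ℕ → ℕ) : Set where
  field
    elem : (k : ℕ) → Fin (g k) → ℕ
    elem-inj : (k : ℕ) → Injective _≡_ _≡_ (elem k)
open Slalom public

InSlalom : {g : ℕ → ℕ} → (ℕ → ℕ) → Slalom g → Set
InSlalom h B = (k : ℕ) → ∃ λ j → elem B k j ≡ h k

Bounded : (ℕ → ℕ) → (ℕ → ℕ) → Set
Bounded f h = (k : ℕ) → h k < f k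

Covers : (f g : ℕ → ℕ) {I : Set} → (I → Slalom g) → Set
Covers f g {I} F = (h : ℕ → ℕ) → Bounded f h → ∃ λ (ι : I) → InSlalom h (F ι)

-- 𝔠(f',g') ≤ 𝔠(f,g): every covering family of g-slaloms for f, indexed by any I,
-- yields a covering family of g'-slaloms for f' indexed by the same I
-- (hence of cardinality ≤ |I|).
CardLe : (f' g' f g : ℕ → ℕ) → Set₁
CardLe f' g' f g = (I : Set) (F : I → Slalom g) → Covers f g F →
  Σ (I → Slalom g') λ F' → Covers f' g' F'

IsPartition : (ℕ → List ℕ) → Set
IsPartition w = ((l : ℕ) → ∃ λ i → l ∈ w i)
              × ((l i j : ℕ) → l ∈ w i → l ∈ w j → i ≡ j)

-- Hypotheses (a),(b),(c) on H^i_l (H i l), with dom H^i_l = {0,…,f'(i)-1}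
-- (values of H i l at n ≥ f'(i) are irrelevant).
HypB : (f f' : ℕ → ℕ) (w : ℕ → List ℕ) (H : ℕ → ℕ → ℕ → ℕ) → Set
HypB f f' w H = (i l : ℕ) → l ∈ w i → (n : ℕ) → n < f' i → H i l n < f l

HypC : (f g f' g' : ℕ → ℕ) (w : ℕ → List ℕ) (H : ℕ → ℕ → ℕ → ℕ) → Set
HypC f g f' g' w H = (i : ℕ) (u : ℕ → List ℕ) →
  ((l : ℕ) → l ∈ w i → Unique (u l) × length (u l) ≤ g l × ((x : ℕ) → x ∈ u l → x < f l)) →
  (S : List ℕ) → Unique S →
  ((n : ℕ) → n ∈ S → n < f' i × ((l : ℕ) → l ∈ w i → H i l n ∈ u l)) →
  length S ≤ g' i

{-# OPTIONS --safe #-}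
-- Each g-slalom B induces a g'-slalom B': in block i, the i-th entry of B' collects the
-- n < f'(i) that the maps H^i_l send into B, that is with H^i_l(n) ∈ B_l ∩ f(l) for all
-- l ∈ w_i; by (c) there are at most g'(i) of them, and we pad up to exactly g'(i).
-- If h' < f' is given, then h(l) := H^i_l(h'(i)) for the block i ∋ l is bounded by f by
-- (b), and whenever h lies in B, h' lies in B'. So B ↦ B' turns a cover into a cover.
module Submission where

open import Defs
open import Data.Nat using (ℕ; _<_; _≤_; _+_; _∸_; suc; _<?_)
open import Data.Nat.Properties
  using (_≟_; m+[n∸m]≡n; ≤-trans; m≤m+n; <-irrefl; +-cancelˡ-≡; ≤-reflexive)
open import Data.List using (List; length; lookup; filter; tabulate; upTo; map; _++_)
open import Data.List.Properties using (length-filter; length-tabulate; length-++; length-map; length-upTo)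
open import Data.List.Membership.Propositional using (_∈_)
open import Data.List.Membership.Propositional.Properties
  using (∈-lookup; ∈-map⁻; ∈-++⁺ˡ; ∈-tabulate⁺; ∈-filter⁺; ∈-filter⁻; ∈-upTo⁺; ∈-upTo⁻)
open import Data.List.Membership.DecPropositional _≟_ using (_∈?_)
open import Data.List.Relation.Unary.Unique.Propositional using (Unique)
import Data.List.Relation.Unary.Unique.Propositional.Properties as Unique
open import Data.List.Relation.Unary.AllPairs using (_∷_)
open import Data.List.Relation.Unary.All as All using (All; all?)
open import Data.List.Relation.Unary.Any using (index)
open import Data.List.Relation.Unary.Any.Properties using (lookup-index)
open import Data.List.Relation.Binary.Disjoint.Propositional using (Disjoint)
open import Data.Fin using (Fin; zero; suc)
open import Data.Product using (Σ; ∃; _×_; _,_; proj₁; proj₂)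
open import Data.Empty using (⊥-elim)
open import Function using (_∘_)
open import Relation.Binary.PropositionalEquality using (_≡_; refl; sym; cong; subst; module ≡-Reasoning)
open import Function.Definitions using (Injective)

lookup-injective : ∀ {a} {A : Set a} {xs : List A} → Unique xs → Injective _≡_ _≡_ (lookup xs)
lookup-injective (_ ∷ _)    {zero}  {zero}  _ = refl
lookup-injective (x∉ ∷ _)   {zero}  {suc j} e = ⊥-elim (All.lookup x∉ (∈-lookup j) e)
lookup-injective (x∉ ∷ _)   {suc i} {zero}  e = ⊥-elim (All.lookup x∉ (∈-lookup i) (sym e))
lookup-injective (_ ∷ uniq) {suc i} {suc j} e = cong suc (lookup-injective uniq e)

BoundedBy : ℕ → List ℕ → Set
BoundedBy b xs = (x : ℕ) → x ∈ xs → x < b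

Admissible : (f g : ℕ → ℕ) → ℕ → List ℕ → Set
Admissible f g l u = Unique u × length u ≤ g l × BoundedBy (f l) u

Contains : {g : ℕ → ℕ} → Slalom g → ℕ → ℕ → Set
Contains B k x = ∃ λ j → elem B k j ≡ x

padTo : ℕ → ℕ → List ℕ → List ℕ
padTo n b xs = xs ++ map (b +_) (upTo (n ∸ length xs))

length-padTo : ∀ {n} b xs → length xs ≤ n → length (padTo n b xs) ≡ n
length-padTo {n} b xs xs≤n = begin
  length (xs ++ map (b +_) (upTo m))       ≡⟨ length-++ xs ⟩
  length xs + length (map (b +_) (upTo m)) ≡⟨ cong (length xs +_) (length-map (b +_) (upTo m)) ⟩
  length xs + length (upTo m)              ≡⟨ cong (length xs +_) (length-upTo m) ⟩
  length xs + m                            ≡⟨ m+[n∸m]≡n xs≤n ⟩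
  n                                        ∎
  where
  open ≡-Reasoning
  m : ℕ
  m = n ∸ length xs

padTo-unique : ∀ n {b xs} → Unique xs → BoundedBy b xs → Unique (padTo n b xs)
padTo-unique n {b} {xs} uniq xs<b =
  Unique.++⁺ uniq (Unique.map⁺ (+-cancelˡ-≡ b _ _) (Unique.upTo⁺ _)) fresh
  where
  fresh : Disjoint xs (map (b +_) (upTo (n ∸ length xs)))
  fresh (x∈xs , x∈fresh) with ∈-map⁻ (b +_) x∈fresh
  ... | y , _ , refl = <-irrefl refl (≤-trans (m≤m+n (suc b) y) (xs<b _ x∈xs))

Enumeration : ℕ → List ℕ → Set
Enumeration n xs = Σ (Fin n → ℕ) λ e → Injective _≡_ _≡_ e × (∀ {x} → x ∈ xs → ∃ λ j → e j ≡ x)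

enumerate : ∀ {n} (xs : List ℕ) → Unique xs → length xs ≡ n → Enumeration n xs
enumerate xs uniq refl = lookup xs , lookup-injective uniq , λ x∈ → index x∈ , sym (lookup-index x∈)

slalom-⊇ : {g : ℕ → ℕ} (b : ℕ → ℕ) (S : ℕ → List ℕ) →
  (∀ k → Unique (S k)) → (∀ k → length (S k) ≤ g k) → (∀ k → BoundedBy (b k) (S k)) →
  Σ (Slalom g) λ B → ∀ k {x} → x ∈ S k → Contains B k x
slalom-⊇ {g} b S uniq short bounded =
  record { elem = proj₁ ∘ slot ; elem-inj = proj₁ ∘ proj₂ ∘ slot } ,
  λ k x∈ → proj₂ (proj₂ (slot k)) (∈-++⁺ˡ x∈)
  where
  slot : ∀ k → Enumeration (g k) (padTo (g k) (b k) (S k))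
  slot k = enumerate (padTo (g k) (b k) (S k))
    (padTo-unique (g k) (uniq k) (bounded k)) (length-padTo (b k) (S k) (short k))

-- B_l ∩ f(l): the set u_l that a g-slalom B offers to hypothesis (c).
trace : (f : ℕ → ℕ) {g : ℕ → ℕ} → Slalom g → ℕ → List ℕ
trace f B l = filter (_<? f l) (tabulate (elem B l))

trace-admissible : (f : ℕ → ℕ) {g : ℕ → ℕ} (B : Slalom g) (l : ℕ) → Admissible f g l (trace f B l)
trace-admissible f B l =
  Unique.filter⁺ (_<? f l) (Unique.tabulate⁺ (elem-inj B l)) ,
  ≤-trans (length-filter (_<? f l) (tabulate (elem B l))) (≤-reflexive (length-tabulate (elem B l))) ,
  λ x x∈ → proj₂ (∈-filter⁻ (_<? f l) {xs = tabulate (elem B l)} x∈)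

∈-trace : (f : ℕ → ℕ) {g : ℕ → ℕ} (B : Slalom g) {l x : ℕ} → Contains B l x → x < f l → x ∈ trace f B l
∈-trace f B {l} (j , refl) x<f = ∈-filter⁺ (_<? f l) (∈-tabulate⁺ j) x<f

module _ (f' : ℕ → ℕ) (w : ℕ → List ℕ) (H : ℕ → ℕ → ℕ → ℕ) where

  LandsIn : (ℕ → List ℕ) → ℕ → ℕ → Set
  LandsIn u i n = All (λ l → H i l n ∈ u l) (w i)

  candidates : (ℕ → List ℕ) → ℕ → List ℕ
  candidates u i = filter (λ n → all? (λ l → H i l n ∈? u l) (w i)) (upTo (f' i))

  candidates-unique : ∀ u i → Unique (candidates u i)
  candidates-unique u i = Unique.filter⁺ _ (Unique.upTo⁺ (f' i))

  candidates-sound : ∀ u i {n} → n ∈ candidates u i → n < f' i × LandsIn u i n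
  candidates-sound u i n∈ with n∈upTo , hits ← ∈-filter⁻ _ {xs = upTo (f' i)} n∈ =
    ∈-upTo⁻ n∈upTo , hits

  ∈-candidates : ∀ u i {n} → n < f' i → LandsIn u i n → n ∈ candidates u i
  ∈-candidates u i n<f' hits = ∈-filter⁺ _ (∈-upTo⁺ n<f') hits

module _ {w : ℕ → List ℕ} (part : IsPartition w) where

  block : ℕ → ℕ
  block l = proj₁ (proj₁ part l)

  ∈-block : ∀ l → l ∈ w (block l)
  ∈-block l = proj₂ (proj₁ part l)

  block-unique : ∀ {l i} → l ∈ w i → block l ≡ i
  block-unique {l} {i} l∈wᵢ = proj₂ part l (block l) i (∈-block l) l∈wᵢ

module Transfer (f g f' g' : ℕ → ℕ) (w : ℕ → List ℕ) (part : IsPartition w)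
  (H : ℕ → ℕ → ℕ → ℕ) (hB : HypB f f' w H) (hC : HypC f g f' g' w H) where

  pullback : (ℕ → ℕ) → ℕ → ℕ
  pullback h' l = H (block part l) l (h' (block part l))

  pullback-on-block : ∀ h' {i l} → l ∈ w i → pullback h' l ≡ H i l (h' i)
  pullback-on-block h' l∈wᵢ rewrite block-unique part l∈wᵢ = refl

  pullback-bounded : ∀ {h'} → Bounded f' h' → Bounded f (pullback h')
  pullback-bounded {h'} h'<f' l =
    hB (block part l) l (∈-block part l) (h' (block part l)) (h'<f' (block part l))

  captured : Slalom g → ℕ → List ℕ
  captured B = candidates f' w H (trace f B)

  length-captured : ∀ B i → length (captured B i) ≤ g' i
  length-captured B i = hC i (trace f B) (λ l _ → trace-admissible f B l) (captured B i)
    (candidates-unique f' w H (trace f B) i)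
    λ n n∈ → let n<f' , hits = candidates-sound f' w H (trace f B) i n∈ in
      n<f' , λ l l∈wᵢ → All.lookup hits l∈wᵢ

  inducedSlalom : (B : Slalom g) → Σ (Slalom g') λ B' → ∀ i {n} → n ∈ captured B i → Contains B' i n
  inducedSlalom B = slalom-⊇ f' (captured B) (candidates-unique f' w H (trace f B)) (length-captured B)
    λ i n n∈ → proj₁ (candidates-sound f' w H (trace f B) i n∈)

  ∈-captured : ∀ {h'} B → Bounded f' h' → InSlalom (pullback h') B → ∀ i → h' i ∈ captured B i
  ∈-captured {h'} B h'<f' h∈B i = ∈-candidates f' w H (trace f B) i (h'<f' i) (All.tabulate hit)
    where
    hit : ∀ {l} → l ∈ w i → H i l (h' i) ∈ trace f B l
    hit {l} l∈wᵢ = ∈-trace f B (subst (Contains B l) (pullback-on-block h' l∈wᵢ) (h∈B l))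
      (hB i l l∈wᵢ (h' i) (h'<f' i))

lemma1p8 : (f g f' g' : ℕ → ℕ) →
    ((k : ℕ) → 0 < f k) → ((k : ℕ) → 0 < g k) → ((k : ℕ) → 0 < f' k) → ((k : ℕ) → 0 < g' k) →
    ((k : ℕ) → g k < f k) →
    (w : ℕ → List ℕ) → IsPartition w →
    (H : ℕ → ℕ → ℕ → ℕ) → HypB f f' w H → HypC f g f' g' w H →
    CardLe f' g' f g
lemma1p8 f g f' g' _ _ _ _ _ w part H hB hC I F cover = proj₁ ∘ inducedSlalom ∘ F , covered
  where
  open Transfer f g f' g' w part H hB hC

  covered : Covers f' g' (proj₁ ∘ inducedSlalom ∘ F)
  covered h' h'<f' with ι , h∈Fι ← cover (pullback h') (pullback-bounded h'<f') =
    ι , λ i → proj₂ (inducedSlalom (F ι)) i (∈-captured (F ι) h'<f' h∈Fι i)
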